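{- For any integers $k \geqslant 4$ and $d \geqslant k-1$, there exists a Cayley digraph that has diameter $k$, outdegree $d$, and order $(k-1)(d-k+3)^{k-1}$.
   Context: For a group $G$ and a subset $S\subseteq G$ not containing the identity, the Cayley digraph of $G$ generated by $S$ has vertex set $G$ and a directed edge from $g$ to $gs$ for every $g\in G$ and $s\in S$; it is regular of outdegree $|S|$. Its order is $|G|$, and its diameter is the maximum over ordered pairs of vertices of the length of a shortest directed path from the first to the second. -}

module Defs where

open import Level using (0ℓ)
open import Data.Nat using (ℕ; _≤_)
open import Data.Fin using (Fin)
open import Data.Vec using (Vec; lookup)
open import Data.List using (List; []; _∷_; length)
open import Data.Product using (Σ; ∃; _×_; _,_)
open import Relation.Nullary using (¬_)
open import Relation.Binary.PropositionalEquality as P using (_≡_)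
open import Function.Bundles using (Inverse)
open import Algebra.Bundles using (Group)

module _ (G : Group 0ℓ 0ℓ) where
  open Group G

  HasOrder : ℕ → Set
  HasOrder n = Inverse (P.setoid (Fin n)) setoid

  ValidConnectionSet : {d : ℕ} → Vec Carrier d → Set
  ValidConnectionSet {d} S =
    ((i : Fin d) → ¬ (lookup S i ≈ ε)) ×
    ((i j : Fin d) → lookup S i ≈ lookup S j → i ≡ j)

  walk : {d : ℕ} → Vec Carrier d → Carrier → List (Fin d) → Carrier
  walk S g []       = g
  walk S g (i ∷ w)  = walk S (g ∙ lookup S i) w

  DistLe : {d : ℕ} → Vec Carrier d → Carrier → Carrier → ℕ → Set
  DistLe {d} S g h ℓ = Σ (List (Fin d)) λ w → (length w ≤ ℓ) × (walk S g w ≈ h)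

  HasDiameter : {d : ℕ} → Vec Carrier d → ℕ → Set
  HasDiameter S k =
    ((g h : Carrier) → DistLe S g h k) ×
    Σ Carrier λ g → Σ Carrier λ h →
      ((ℓ : ℕ) → DistLe S g h ℓ → k ≤ ℓ)

-- The digraph is the Cayley digraph of the lamplighter group ℤq ≀ ℤn with n = k − 1 and
-- q = d − k + 3, generated by the n − 1 pointer moves (j, 0), j ≠ 0, and the q − 1 moves
-- (1, c·δ₀), c ≠ 0, that light the current lamp with colour c and advance the pointer.
-- Since (1, 0) is itself a generator, any lamp configuration is written in n such steps
-- around the cycle, and one more pointer move reaches any element: diameter ≤ k.
-- Conversely, the number of lit lamps plus the indicator "pointer ≠ that number (mod n)"
-- grows by at most one per step, is 0 at ε and n + 1 = k at (1, all lamps lit).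
module Submission where

open import Defs
open import Level using (0ℓ)
open import Data.Nat using (ℕ; _≤_; _∸_; _+_; _*_; _^_)
open import Data.Vec using (Vec)
open import Data.Product using (Σ; _×_)
open import Algebra.Bundles using (Group)

open import Algebra.Core using (Op₁; Op₂)
import Algebra.Properties.Group as GroupProperties
open import Data.Bool using (true; false; if_then_else_)
open import Data.Fin using (Fin; zero; suc; toℕ; splitAt; join; finToFun; funToFin; combine)
open import Data.Fin.Properties
  using (toℕ-injective; toℕ-fromℕ<; toℕ<n; splitAt-join; join-splitAt; suc-injective; *↔×;
         finToFun-funToFin; funToFin-finToFin)
  renaming (_≟_ to _≟ᶠ_)
open import Data.List using (List; []; _∷_; _∷ʳ_; length)
open import Data.List.Properties using (length-++)
open import Data.Nat using (zero; suc; _<_; _<?_; z≤n; s≤s; NonZero)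
open import Data.Nat.DivMod using (_%_; _mod_; %-distribˡ-+; [m+n]%n≡m%n; m<n⇒m%n≡m)
import Data.Nat.Properties as ℕₚ
open import Data.Product using (_,_)
open import Data.Product.Function.NonDependent.Setoid using (_×-inverse_)
open import Data.Product.Relation.Binary.Pointwise.NonDependent using (_×ₛ_; Pointwise-≡↔≡)
open import Data.Sum using (_⊎_; inj₁; inj₂)
import Data.Vec.Functional.Relation.Binary.Equality.Setoid as VectorEquality
open import Data.Vec using (lookup; tabulate)
open import Data.Vec.Properties using (lookup∘tabulate)
open import Data.Empty using (⊥-elim)
open import Function using (_∘_)
open import Function.Bundles using (Inverse)
open import Function.Consequences.Setoid using (strictlyInverseˡ⇒inverseˡ; strictlyInverseʳ⇒inverseʳ)
import Function.Construct.Composition as Compose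
import Function.Construct.Identity as Identity
import Function.Construct.Symmetry as Symmetry
import Relation.Binary.Reasoning.Setoid
open import Relation.Binary.Bundles using (Setoid)
open import Relation.Binary.PropositionalEquality as P
  using (_≡_; _≢_; refl; sym; trans; cong; cong₂; subst; subst₂)
open import Relation.Nullary using (¬_; does; yes; no)
open import Relation.Nullary.Decidable using (dec-true; dec-false)

module ℤMod (n : ℕ) .{{_ : NonZero n}} where

  open P.≡-Reasoning

  [_] : ℕ → Fin n
  [ x ] = x mod n

  infixl 6 _⊕_
  _⊕_ : Op₂ (Fin n)
  a ⊕ b = [ toℕ a + toℕ b ]

  ⊝_ : Op₁ (Fin n)
  ⊝ a = [ n ∸ toℕ a ]

  0# : Fin n
  0# = [ 0 ]

  toℕ-[] : ∀ x → toℕ [ x ] ≡ x % n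
  toℕ-[] x = toℕ-fromℕ< _

  toℕ-[]< : ∀ {x} → x < n → toℕ [ x ] ≡ x
  toℕ-[]< x<n = trans (toℕ-[] _) (m<n⇒m%n≡m x<n)

  []-toℕ : ∀ a → [ toℕ a ] ≡ a
  []-toℕ a = toℕ-injective (toℕ-[]< (toℕ<n a))

  []-⊕ : ∀ x y → [ x + y ] ≡ [ x ] ⊕ [ y ]
  []-⊕ x y = toℕ-injective (begin
    toℕ [ x + y ]               ≡⟨ toℕ-[] (x + y) ⟩
    (x + y) % n                 ≡⟨ %-distribˡ-+ x y n ⟩
    (x % n + y % n) % n         ≡⟨ cong₂ (λ a b → (a + b) % n) (toℕ-[] x) (toℕ-[] y) ⟨
    (toℕ [ x ] + toℕ [ y ]) % n ≡⟨ toℕ-[] _ ⟨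
    toℕ ([ x ] ⊕ [ y ])         ∎)

  []-suc : ∀ x → [ suc x ] ≡ [ x ] ⊕ [ 1 ]
  []-suc x = trans (cong [_] (ℕₚ.+-comm 1 x)) ([]-⊕ x 1)

  [n]≡0# : [ n ] ≡ 0#
  [n]≡0# = toℕ-injective (trans (toℕ-[] n) (trans ([m+n]%n≡m%n 0 n) (sym (toℕ-[] 0))))

  ⊕-assoc : ∀ a b c → (a ⊕ b) ⊕ c ≡ a ⊕ (b ⊕ c)
  ⊕-assoc a b c = begin
    (a ⊕ b) ⊕ c                   ≡⟨ cong ((a ⊕ b) ⊕_) ([]-toℕ c) ⟨
    [ toℕ a + toℕ b ] ⊕ [ toℕ c ] ≡⟨ []-⊕ (toℕ a + toℕ b) (toℕ c) ⟨
    [ toℕ a + toℕ b + toℕ c ]     ≡⟨ cong [_] (ℕₚ.+-assoc (toℕ a) (toℕ b) (toℕ c)) ⟩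
    [ toℕ a + (toℕ b + toℕ c) ]   ≡⟨ []-⊕ (toℕ a) (toℕ b + toℕ c) ⟩
    [ toℕ a ] ⊕ (b ⊕ c)           ≡⟨ cong (_⊕ (b ⊕ c)) ([]-toℕ a) ⟩
    a ⊕ (b ⊕ c)                   ∎

  ⊕-identityˡ : ∀ a → 0# ⊕ a ≡ a
  ⊕-identityˡ a = begin
    0# ⊕ a            ≡⟨ cong (0# ⊕_) ([]-toℕ a) ⟨
    [ 0 ] ⊕ [ toℕ a ] ≡⟨ []-⊕ 0 (toℕ a) ⟨
    [ toℕ a ]         ≡⟨ []-toℕ a ⟩
    a                 ∎

  ⊕-identityʳ : ∀ a → a ⊕ 0# ≡ a
  ⊕-identityʳ a = begin
    a ⊕ 0#            ≡⟨ cong (_⊕ 0#) ([]-toℕ a) ⟨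
    [ toℕ a ] ⊕ [ 0 ] ≡⟨ []-⊕ (toℕ a) 0 ⟨
    [ toℕ a + 0 ]     ≡⟨ cong [_] (ℕₚ.+-identityʳ (toℕ a)) ⟩
    [ toℕ a ]         ≡⟨ []-toℕ a ⟩
    a                 ∎

  ⊕-inverseˡ : ∀ a → ⊝ a ⊕ a ≡ 0#
  ⊕-inverseˡ a = begin
    ⊝ a ⊕ a                   ≡⟨ cong (⊝ a ⊕_) ([]-toℕ a) ⟨
    [ n ∸ toℕ a ] ⊕ [ toℕ a ] ≡⟨ []-⊕ (n ∸ toℕ a) (toℕ a) ⟨
    [ n ∸ toℕ a + toℕ a ]     ≡⟨ cong [_] (ℕₚ.m∸n+n≡m (ℕₚ.<⇒≤ (toℕ<n a))) ⟩
    [ n ]                     ≡⟨ [n]≡0# ⟩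
    0#                        ∎

  ⊕-inverseʳ : ∀ a → a ⊕ ⊝ a ≡ 0#
  ⊕-inverseʳ a = begin
    a ⊕ ⊝ a                   ≡⟨ cong (_⊕ ⊝ a) ([]-toℕ a) ⟨
    [ toℕ a ] ⊕ [ n ∸ toℕ a ] ≡⟨ []-⊕ (toℕ a) (n ∸ toℕ a) ⟨
    [ toℕ a + (n ∸ toℕ a) ]   ≡⟨ cong [_] (ℕₚ.m+[n∸m]≡n (ℕₚ.<⇒≤ (toℕ<n a))) ⟩
    [ n ]                     ≡⟨ [n]≡0# ⟩
    0#                        ∎

  group : Group 0ℓ 0ℓ
  group = record
    { Carrier = Fin n ; _≈_ = _≡_ ; _∙_ = _⊕_ ; ε = 0# ; _⁻¹ = ⊝_
    ; isGroup = record
      { isMonoid = record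
        { isSemigroup = record
          { isMagma = record { isEquivalence = P.isEquivalence ; ∙-cong = cong₂ _⊕_ }
          ; assoc = ⊕-assoc }
        ; identity = ⊕-identityˡ , ⊕-identityʳ }
      ; inverse = ⊕-inverseˡ , ⊕-inverseʳ
      ; ⁻¹-cong = cong ⊝_ } }

  order : HasOrder group n
  order = Identity.inverse (P.setoid (Fin n))

ℤ/_ : (n : ℕ) .{{_ : NonZero n}} → Group 0ℓ 0ℓ
ℤ/ n = ℤMod.group n

module Wreath (H : Group 0ℓ 0ℓ) (n : ℕ) .{{_ : NonZero n}} where

  private
    module H = Group H
    module K = Group (ℤ/ n)
    module KP = GroupProperties (ℤ/ n)
    open VectorEquality H.setoid using (≋-setoid)

  -- The carrier setoid is literally this product, so that `order` is assembled from library bijections.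
  Elements : Setoid 0ℓ 0ℓ
  Elements = P.setoid (Fin n) ×ₛ ≋-setoid n

  open Setoid Elements using (Carrier; _≈_)

  \\-∙ : ∀ i j t → (i K.∙ j) K.\\ t ≡ j K.\\ (i K.\\ t)
  \\-∙ i j t = trans (cong (K._∙ t) (KP.⁻¹-anti-homo-∙ i j)) (K.assoc (j K.⁻¹) (i K.⁻¹) t)

  ε\\t≡t : ∀ t → K.ε K.\\ t ≡ t
  ε\\t≡t t = trans (cong (K._∙ t) KP.ε⁻¹≈ε) (K.identityˡ t)

  infixl 7 _∙_
  _∙_ : Op₂ Carrier
  (i , v) ∙ (j , w) = (i K.∙ j , λ t → v t H.∙ w (i K.\\ t))

  ε : Carrier
  ε = (K.ε , λ _ → H.ε)

  _⁻¹ : Op₁ Carrier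
  (i , v) ⁻¹ = (i K.⁻¹ , λ t → v (i K.∙ t) H.⁻¹)

  ∙-cong : ∀ {x x′ y y′} → x ≈ x′ → y ≈ y′ → x ∙ y ≈ x′ ∙ y′
  ∙-cong {i , _} (refl , v≋v′) (refl , w≋w′) = refl , λ t → H.∙-cong (v≋v′ t) (w≋w′ (i K.\\ t))

  ⁻¹-cong : ∀ {x y} → x ≈ y → x ⁻¹ ≈ y ⁻¹
  ⁻¹-cong {i , _} (refl , v≋w) = refl , λ t → H.⁻¹-cong (v≋w (i K.∙ t))

  assoc : ∀ x y z → (x ∙ y) ∙ z ≈ x ∙ (y ∙ z)
  assoc (i , v) (j , w) (l , u) = K.assoc i j l , λ t →
    H.trans (H.assoc (v t) (w (i K.\\ t)) (u ((i K.∙ j) K.\\ t)))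
            (H.∙-congˡ (H.∙-congˡ (H.reflexive (cong u (\\-∙ i j t)))))

  identityˡ : ∀ x → ε ∙ x ≈ x
  identityˡ (j , w) = K.identityˡ j , λ t → H.trans (H.identityˡ _) (H.reflexive (cong w (ε\\t≡t t)))

  identityʳ : ∀ x → x ∙ ε ≈ x
  identityʳ (i , v) = K.identityʳ i , λ t → H.identityʳ (v t)

  inverseˡ : ∀ x → x ⁻¹ ∙ x ≈ ε
  inverseˡ (i , v) = K.inverseˡ i , λ t →
    H.trans (H.∙-congˡ (H.reflexive (cong v (cong (K._∙ t) (KP.⁻¹-involutive i))))) (H.inverseˡ (v (i K.∙ t)))

  inverseʳ : ∀ x → x ∙ x ⁻¹ ≈ ε
  inverseʳ (i , v) = K.inverseʳ i , λ t →
    H.trans (H.∙-congˡ (H.⁻¹-cong (H.reflexive (cong v (KP.\\-leftDividesˡ i t))))) (H.inverseʳ (v t))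

  group : Group 0ℓ 0ℓ
  group = record
    { Carrier = Carrier ; _≈_ = _≈_ ; _∙_ = _∙_ ; ε = ε ; _⁻¹ = _⁻¹
    ; isGroup = record
      { isMonoid = record
        { isSemigroup = record
          { isMagma = record { isEquivalence = Setoid.isEquivalence Elements ; ∙-cong = ∙-cong }
          ; assoc = assoc }
        ; identity = identityˡ , identityʳ }
      ; inverse = inverseˡ , inverseʳ
      ; ⁻¹-cong = ⁻¹-cong } }

  private
    funToFin-cong : ∀ {m q} {v w : Fin m → Fin q} → (∀ t → v t ≡ w t) → funToFin v ≡ funToFin w
    funToFin-cong {zero}  v≗w = refl
    funToFin-cong {suc m} v≗w = cong₂ combine (v≗w zero) (funToFin-cong (v≗w ∘ suc))

  ^↔lamps : ∀ {q} → HasOrder H q → Inverse (P.setoid (Fin (q ^ n))) (≋-setoid n)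
  ^↔lamps {q} ∣H∣ = record
    { to = to ; from = from ; to-cong = to-cong ; from-cong = from-cong
    ; inverse = strictlyInverseˡ⇒inverseˡ (P.setoid _) (≋-setoid n) {f = to} {f⁻¹ = from} to-cong to∘from
              , strictlyInverseʳ⇒inverseʳ (P.setoid _) (≋-setoid n) {f⁻¹ = from} {f = to} from-cong from∘to }
    where
    module O = Inverse ∣H∣
    to : Fin (q ^ n) → Fin n → H.Carrier
    to r t = O.to (finToFun r t)
    from : (Fin n → H.Carrier) → Fin (q ^ n)
    from v = funToFin (O.from ∘ v)
    to-cong : ∀ {r s} → r ≡ s → ∀ t → to r t H.≈ to s t
    to-cong refl t = H.refl
    from-cong : ∀ {v w} → (∀ t → v t H.≈ w t) → from v ≡ from w
    from-cong v≋w = funToFin-cong (λ t → O.from-cong (v≋w t))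
    to∘from : ∀ v t → to (from v) t H.≈ v t
    to∘from v t = H.trans (H.reflexive (cong O.to (finToFun-funToFin (O.from ∘ v) t))) (O.strictlyInverseˡ (v t))
    from∘to : ∀ r → from (to r) ≡ r
    from∘to r = trans (funToFin-cong {n} (λ t → O.strictlyInverseʳ (finToFun r t))) (funToFin-finToFin {n} {q} r)

  order : ∀ {q} → HasOrder H q → HasOrder group (n * q ^ n)
  order ∣H∣ = Compose.inverse (Compose.inverse *↔× (Symmetry.inverse Pointwise-≡↔≡))
                              (Identity.inverse (P.setoid (Fin n)) ×-inverse ^↔lamps ∣H∣)

infixl 5 _≀_
_≀_ : Group 0ℓ 0ℓ → (n : ℕ) .{{_ : NonZero n}} → Group 0ℓ 0ℓ
H ≀ n = Wreath.group H n

module Walks (G : Group 0ℓ 0ℓ) {d : ℕ} (S : Vec (Group.Carrier G) d) where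

  open Group G renaming (refl to ≈-refl; sym to ≈-sym)
  private module ≈-Reasoning = Relation.Binary.Reasoning.Setoid setoid

  walk-∷ʳ : ∀ g w i → walk G S g (w ∷ʳ i) ≡ walk G S g w ∙ lookup S i
  walk-∷ʳ g []      i = refl
  walk-∷ʳ g (j ∷ w) i = walk-∷ʳ (g ∙ lookup S j) w i

  walk-cong : ∀ {g h} w → g ≈ h → walk G S g w ≈ walk G S h w
  walk-cong []      g≈h = g≈h
  walk-cong (i ∷ w) g≈h = walk-cong w (∙-congʳ g≈h)

  walk-∙ : ∀ g h w → walk G S (g ∙ h) w ≈ g ∙ walk G S h w
  walk-∙ g h []      = ≈-refl
  walk-∙ g h (i ∷ w) = begin
    walk G S (g ∙ h ∙ lookup S i) w   ≈⟨ walk-cong w (assoc g h (lookup S i)) ⟩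
    walk G S (g ∙ (h ∙ lookup S i)) w ≈⟨ walk-∙ g (h ∙ lookup S i) w ⟩
    g ∙ walk G S (h ∙ lookup S i) w   ∎
    where open ≈-Reasoning

  DistLe-fromε : ∀ {ℓ} → (∀ h → DistLe G S ε h ℓ) → ∀ g h → DistLe G S g h ℓ
  DistLe-fromε reach g h with reach (g ⁻¹ ∙ h)
  ... | w , |w|≤ℓ , w-reaches = w , |w|≤ℓ , (begin
    walk G S g w       ≈⟨ walk-cong w (identityʳ g) ⟨
    walk G S (g ∙ ε) w ≈⟨ walk-∙ g ε w ⟩
    g ∙ walk G S ε w   ≈⟨ ∙-congˡ w-reaches ⟩
    g ∙ (g ⁻¹ ∙ h)     ≈⟨ assoc g (g ⁻¹) h ⟨
    g ∙ g ⁻¹ ∙ h       ≈⟨ ∙-congʳ (inverseʳ g) ⟩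
    ε ∙ h              ≈⟨ identityˡ h ⟩
    h                  ∎)
    where open ≈-Reasoning

  module _ (φ : Carrier → ℕ) (φ-cong : ∀ {x y} → x ≈ y → φ x ≡ φ y)
           (φ-step : ∀ g i → φ (g ∙ lookup S i) ≤ suc (φ g)) where

    walk-potential : ∀ g w → φ (walk G S g w) ≤ φ g + length w
    walk-potential g []      = ℕₚ.≤-reflexive (sym (ℕₚ.+-identityʳ (φ g)))
    walk-potential g (i ∷ w) = begin
      φ (walk G S (g ∙ lookup S i) w) ≤⟨ walk-potential (g ∙ lookup S i) w ⟩
      φ (g ∙ lookup S i) + length w   ≤⟨ ℕₚ.+-monoˡ-≤ (length w) (φ-step g i) ⟩
      suc (φ g) + length w            ≡⟨ ℕₚ.+-suc (φ g) (length w) ⟨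
      φ g + length (i ∷ w)            ∎
      where open ℕₚ.≤-Reasoning

    DistLe⇒potential≤ : ∀ {g h ℓ} → DistLe G S g h ℓ → φ h ≤ φ g + ℓ
    DistLe⇒potential≤ {g} (w , |w|≤ℓ , w-reaches) =
      ℕₚ.≤-trans (ℕₚ.≤-reflexive (φ-cong (≈-sym w-reaches)))
        (ℕₚ.≤-trans (walk-potential g w) (ℕₚ.+-monoʳ-≤ (φ g) |w|≤ℓ))

nonzero : ∀ {q} → Fin q → ℕ
nonzero zero    = 0
nonzero (suc _) = 1

weight : ∀ {q m} → (Fin m → Fin q) → ℕ
weight {m = zero}  v = 0
weight {m = suc m} v = nonzero (v zero) + weight (v ∘ suc)

weight-cong : ∀ {q m} {v w : Fin m → Fin q} → (∀ t → v t ≡ w t) → weight v ≡ weight w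
weight-cong {m = zero}  v≗w = refl
weight-cong {m = suc m} v≗w = cong₂ _+_ (cong nonzero (v≗w zero)) (weight-cong (v≗w ∘ suc))

weight-update : ∀ {q m} (p : Fin m) (v w : Fin m → Fin q) →
                (∀ t → t ≢ p → w t ≡ v t) → weight w ≤ suc (weight v)
weight-update zero v w agree = begin
  nonzero (w zero) + weight (w ∘ suc) ≤⟨ ℕₚ.+-monoˡ-≤ _ (nonzero≤1 (w zero)) ⟩
  1 + weight (w ∘ suc)                ≡⟨ cong suc (weight-cong (λ t → agree (suc t) λ ())) ⟩
  1 + weight (v ∘ suc)                ≤⟨ s≤s (ℕₚ.m≤n+m _ (nonzero (v zero))) ⟩
  suc (weight v)                      ∎
  where
  open ℕₚ.≤-Reasoning
  nonzero≤1 : ∀ {q} (c : Fin q) → nonzero c ≤ 1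
  nonzero≤1 zero    = z≤n
  nonzero≤1 (suc _) = s≤s z≤n
weight-update (suc p) v w agree = begin
  nonzero (w zero) + weight (w ∘ suc)       ≡⟨ cong (_+ weight (w ∘ suc)) (cong nonzero (agree zero λ ())) ⟩
  nonzero (v zero) + weight (w ∘ suc)       ≤⟨ ℕₚ.+-monoʳ-≤ (nonzero (v zero)) (weight-update p (v ∘ suc) (w ∘ suc) agree′) ⟩
  nonzero (v zero) + suc (weight (v ∘ suc)) ≡⟨ ℕₚ.+-suc _ _ ⟩
  suc (weight v)                            ∎
  where
  open ℕₚ.≤-Reasoning
  agree′ : ∀ t → t ≢ p → w (suc t) ≡ v (suc t)
  agree′ t t≢p = agree (suc t) (t≢p ∘ suc-injective)

weight-zero : ∀ {q m} → weight {suc q} {m} (λ _ → zero) ≡ 0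
weight-zero {m = zero}  = refl
weight-zero {m = suc m} = weight-zero {m = m}

weight-nonzero : ∀ {q m} (c : Fin q) → weight {suc q} {m} (λ _ → suc c) ≡ m
weight-nonzero {m = zero}  c = refl
weight-nonzero {m = suc m} c = cong suc (weight-nonzero {m = m} c)

length-∷ʳ : ∀ {A : Set} (w : List A) x → length (w ∷ʳ x) ≡ suc (length w)
length-∷ʳ w x = trans (length-++ w) (ℕₚ.+-comm (length w) 1)

CayleyDigraph : (k d N : ℕ) → Set₁
CayleyDigraph k d N = Σ (Group 0ℓ 0ℓ) λ G → Σ (Vec (Group.Carrier G) d) λ S →
  ValidConnectionSet G S × HasDiameter G S k × HasOrder G N

module Lamplighter (n-2 q-2 : ℕ) where

  n q : ℕ
  n = suc (suc n-2)
  q = suc (suc q-2)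

  private
    module ℤn = ℤMod n
    module ℤq = ℤMod q
    module K = Group (ℤ/ n)
    module KP = GroupProperties (ℤ/ n)

  G : Group 0ℓ 0ℓ
  G = ℤ/ q ≀ n

  open Group G using (Carrier; _≈_; _∙_; ε; setoid)
  private module ≈-Reasoning = Relation.Binary.Reasoning.Setoid setoid

  atOrigin : Fin q → Fin n → Fin q
  atOrigin c zero    = c
  atOrigin c (suc _) = zero

  atOrigin-here : ∀ c i → atOrigin c (i K.\\ i) ≡ c
  atOrigin-here c i = cong (atOrigin c) (K.inverseˡ i)

  atOrigin-elsewhere : ∀ c {i t} → t ≢ i → atOrigin c (i K.\\ t) ≡ zero
  atOrigin-elsewhere c {i} {t} t≢i with i K.\\ t in i\\t≡s
  ... | zero  = ⊥-elim (t≢i (begin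
        t                ≡⟨ KP.\\-leftDividesˡ i t ⟨
        i K.∙ (i K.\\ t) ≡⟨ cong (i K.∙_) i\\t≡s ⟩
        i K.∙ zero       ≡⟨ K.identityʳ i ⟩
        i                ∎))
    where open P.≡-Reasoning
  ... | suc _ = refl

  pointerMove : Fin (suc n-2) → Carrier
  pointerMove j = (suc j , λ _ → zero)

  lampMove : Fin q → Carrier
  lampMove c = (suc zero , atOrigin c)

  generator : Fin (suc n-2) ⊎ Fin (suc q-2) → Carrier
  generator (inj₁ j) = pointerMove j
  generator (inj₂ c) = lampMove (suc c)

  D : ℕ
  D = suc n-2 + suc q-2

  S : Vec Carrier D
  S = tabulate (generator ∘ splitAt (suc n-2))

  lookup-S : ∀ i → lookup S i ≡ generator (splitAt (suc n-2) i)
  lookup-S = lookup∘tabulate _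

  generator-injective : ∀ x y → generator x ≈ generator y → x ≡ y
  generator-injective (inj₁ j) (inj₁ j′) (sj≡sj′ , _) = cong inj₁ (suc-injective sj≡sj′)
  generator-injective (inj₁ j) (inj₂ c)  (_ , lamps≡) with () ← lamps≡ zero
  generator-injective (inj₂ c) (inj₁ j)  (_ , lamps≡) with () ← lamps≡ zero
  generator-injective (inj₂ c) (inj₂ c′) (_ , lamps≡) = cong inj₂ (suc-injective (lamps≡ zero))

  generator≉ε : ∀ x → ¬ generator x ≈ ε
  generator≉ε (inj₁ _) (() , _)
  generator≉ε (inj₂ _) (() , _)

  lookup-S≉ε : ∀ i → ¬ lookup S i ≈ ε
  lookup-S≉ε i = subst (λ s → ¬ s ≈ ε) (sym (lookup-S i)) (generator≉ε (splitAt (suc n-2) i))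

  lookup-S-injective : ∀ i j → lookup S i ≈ lookup S j → i ≡ j
  lookup-S-injective i j Sᵢ≈Sⱼ = begin
    i                              ≡⟨ join-splitAt (suc n-2) (suc q-2) i ⟨
    join _ _ (splitAt (suc n-2) i) ≡⟨ cong (join _ _) (generator-injective (splitAt _ i) (splitAt _ j) generatorᵢ≈generatorⱼ) ⟩
    join _ _ (splitAt (suc n-2) j) ≡⟨ join-splitAt (suc n-2) (suc q-2) j ⟩
    j                              ∎
    where
    open P.≡-Reasoning
    generatorᵢ≈generatorⱼ : generator (splitAt (suc n-2) i) ≈ generator (splitAt (suc n-2) j)
    generatorᵢ≈generatorⱼ = subst₂ _≈_ (lookup-S i) (lookup-S j) Sᵢ≈Sⱼ

  valid : ValidConnectionSet G S
  valid = lookup-S≉ε , lookup-S-injective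

  pointerIndex : Fin (suc n-2) → Fin D
  pointerIndex j = join (suc n-2) (suc q-2) (inj₁ j)

  lookup-pointerIndex : ∀ j → lookup S (pointerIndex j) ≡ pointerMove j
  lookup-pointerIndex j = trans (lookup-S (pointerIndex j)) (cong generator (splitAt-join (suc n-2) (suc q-2) (inj₁ j)))

  -- the generator (1, 0) doubles as the lamp move of colour 0
  lampIndex : Fin q → Fin D
  lampIndex zero    = pointerIndex zero
  lampIndex (suc c) = join (suc n-2) (suc q-2) (inj₂ c)

  lookup-lampIndex : ∀ c → lookup S (lampIndex c) ≈ lampMove c
  lookup-lampIndex zero    rewrite lookup-pointerIndex zero = refl , λ { zero → refl ; (suc _) → refl }
  lookup-lampIndex (suc c) rewrite lookup-S (lampIndex (suc c)) | splitAt-join (suc n-2) (suc q-2) (inj₂ c) =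
    refl , λ _ → refl

  open Walks G S

  truncate : ℕ → (Fin n → Fin q) → Fin n → Fin q
  truncate m v t = if does (toℕ t <? m) then v t else zero

  truncate-at : ∀ {m} v t → toℕ t ≡ m → truncate m v t ≡ zero
  truncate-at v t t≡m = cong (if_then v t else zero) (dec-false (_ <? _) (ℕₚ.<-irrefl t≡m))

  truncate-suc-at : ∀ {m} v t → toℕ t ≡ m → truncate (suc m) v t ≡ v t
  truncate-suc-at v t t≡m = cong (if_then v t else zero) (dec-true (_ <? _) (s≤s (ℕₚ.≤-reflexive t≡m)))

  truncate-suc : ∀ {m} v t → toℕ t ≢ m → truncate (suc m) v t ≡ truncate m v t
  truncate-suc {m} v t t≢m with toℕ t <? m
  ... | yes t<m = trans (select (dec-true (_ <? _) (ℕₚ.m<n⇒m<1+n t<m))) (sym (select (dec-true (_ <? _) t<m)))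
    where select = cong (if_then v t else zero)
  ... | no  t≮m = trans (select (dec-false (_ <? _) t≮1+m)) (sym (select (dec-false (_ <? _) t≮m)))
    where
    select = cong (if_then v t else zero)
    t≮1+m : ¬ toℕ t < suc m
    t≮1+m t<1+m = t≮m (ℕₚ.≤∧≢⇒< (ℕₚ.≤-pred t<1+m) t≢m)

  truncate-all : ∀ v t → truncate n v t ≡ v t
  truncate-all v t = cong (if_then v t else zero) (dec-true (_ <? _) (toℕ<n t))

  prefix : (Fin n → Fin q) → ℕ → Carrier
  prefix v m = (ℤn.[ m ] , truncate m v)

  prefix-step : ∀ v {m} → m < n → prefix v m ∙ lampMove (v ℤn.[ m ]) ≈ prefix v (suc m)
  prefix-step v {m} m<n = sym (ℤn.[]-suc m) , lamps
    where
    p = ℤn.[ m ]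
    lamps : ∀ t → truncate m v t ℤq.⊕ atOrigin (v p) (p K.\\ t) ≡ truncate (suc m) v t
    lamps t with t ≟ᶠ p
    ... | yes refl = begin
      truncate m v p ℤq.⊕ atOrigin (v p) (p K.\\ p) ≡⟨ cong₂ ℤq._⊕_ (truncate-at v p (ℤn.toℕ-[]< m<n)) (atOrigin-here (v p) p) ⟩
      zero ℤq.⊕ v p                                 ≡⟨ ℤq.⊕-identityˡ (v p) ⟩
      v p                                           ≡⟨ truncate-suc-at v p (ℤn.toℕ-[]< m<n) ⟨
      truncate (suc m) v p                          ∎
      where open P.≡-Reasoning
    ... | no t≢p = begin
      truncate m v t ℤq.⊕ atOrigin (v p) (p K.\\ t) ≡⟨ cong (truncate m v t ℤq.⊕_) (atOrigin-elsewhere (v p) t≢p) ⟩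
      truncate m v t ℤq.⊕ zero                      ≡⟨ ℤq.⊕-identityʳ (truncate m v t) ⟩
      truncate m v t                                ≡⟨ truncate-suc v t (λ t≡m → t≢p (trans (sym (ℤn.[]-toℕ t)) (cong ℤn.[_] t≡m))) ⟨
      truncate (suc m) v t                          ∎
      where open P.≡-Reasoning

  prefix-reachable : ∀ v m → m ≤ n → Σ (List (Fin D)) λ w → length w ≡ m × walk G S ε w ≈ prefix v m
  prefix-reachable v zero    _   = [] , refl , (refl , λ _ → refl)
  prefix-reachable v (suc m) m<n with prefix-reachable v m (ℕₚ.<⇒≤ m<n)
  ... | w , |w|≡m , w-reaches = w ∷ʳ x , trans (length-∷ʳ w x) (cong suc |w|≡m) , (begin
    walk G S ε (w ∷ʳ x)                ≡⟨ walk-∷ʳ ε w x ⟩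
    walk G S ε w ∙ lookup S x          ≈⟨ Group.∙-cong G w-reaches (lookup-lampIndex (v ℤn.[ m ])) ⟩
    prefix v m ∙ lampMove (v ℤn.[ m ]) ≈⟨ prefix-step v m<n ⟩
    prefix v (suc m)                   ∎)
    where
    open ≈-Reasoning
    x = lampIndex (v ℤn.[ m ])

  prefix-full : ∀ v → prefix v n ≈ (zero , v)
  prefix-full v = ℤn.[n]≡0# , truncate-all v

  reachable : ∀ h → DistLe G S ε h (suc n)
  reachable (i , v) with prefix-reachable v n ℕₚ.≤-refl
  reachable (zero , v) | w , |w|≡n , w-reaches =
    w , ℕₚ.≤-trans (ℕₚ.≤-reflexive |w|≡n) (ℕₚ.n≤1+n n) , Group.trans G w-reaches (prefix-full v)
  reachable (suc j , v) | w , |w|≡n , w-reaches =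
    w ∷ʳ y , ℕₚ.≤-reflexive (trans (length-∷ʳ w y) (cong suc |w|≡n)) , (begin
      walk G S ε (w ∷ʳ y)        ≡⟨ walk-∷ʳ ε w y ⟩
      walk G S ε w ∙ lookup S y  ≈⟨ Group.∙-cong G (Group.trans G w-reaches (prefix-full v))
                                                   (Group.reflexive G (lookup-pointerIndex j)) ⟩
      (zero , v) ∙ pointerMove j ≈⟨ K.identityˡ (suc j) , (λ t → ℤq.⊕-identityʳ (v t)) ⟩
      (suc j , v)                ∎)
    where
    open ≈-Reasoning
    y = pointerIndex j

  offset : Fin n → ℕ → ℕ
  offset i c = if does (i ≟ᶠ ℤn.[ c ]) then 0 else 1

  offset+≤ : ∀ i c → offset i c + c ≤ suc c
  offset+≤ i c with does (i ≟ᶠ ℤn.[ c ])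
  ... | true  = ℕₚ.n≤1+n c
  ... | false = ℕₚ.≤-refl

  offset-step : ∀ i c c′ → c′ ≤ suc c → offset (i K.∙ suc zero) c′ + c′ ≤ suc (offset i c + c)
  offset-step i c c′ c′≤1+c with i ≟ᶠ ℤn.[ c ] | ℕₚ.m≤n⇒m<n∨m≡n c′≤1+c
  ... | yes refl | inj₂ refl =
    ℕₚ.≤-reflexive (cong (λ b → (if b then 0 else 1) + suc c) (dec-true (_ ≟ᶠ _) (sym (ℤn.[]-suc c))))
  ... | yes _    | inj₁ c′<1+c = ℕₚ.≤-trans (offset+≤ (i K.∙ suc zero) c′) c′<1+c
  ... | no  _    | _           = ℕₚ.≤-trans (offset+≤ (i K.∙ suc zero) c′) (s≤s c′≤1+c)

  potential : Carrier → ℕ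
  potential (i , v) = offset i (weight v) + weight v

  potential-cong : ∀ {x y} → x ≈ y → potential x ≡ potential y
  potential-cong {i , _} (refl , v≗w) = cong (λ c → offset i c + c) (weight-cong v≗w)

  potential-generator : ∀ g x → potential (g ∙ generator x) ≤ suc (potential g)
  potential-generator (i , v) (inj₁ j) = begin
    potential ((i , v) ∙ pointerMove j) ≤⟨ offset+≤ (i K.∙ suc j) (weight (λ t → v t ℤq.⊕ zero)) ⟩
    suc (weight (λ t → v t ℤq.⊕ zero))  ≡⟨ cong suc (weight-cong (λ t → ℤq.⊕-identityʳ (v t))) ⟩
    suc (weight v)                      ≤⟨ s≤s (ℕₚ.m≤n+m (weight v) (offset i (weight v))) ⟩
    suc (potential (i , v))             ∎
    where open ℕₚ.≤-Reasoning
  potential-generator (i , v) (inj₂ c) = offset-step i (weight v) _ (weight-update i v _ unchanged)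
    where
    unchanged : ∀ t → t ≢ i → v t ℤq.⊕ atOrigin (suc c) (i K.\\ t) ≡ v t
    unchanged t t≢i = trans (cong (v t ℤq.⊕_) (atOrigin-elsewhere (suc c) t≢i)) (ℤq.⊕-identityʳ (v t))

  potential-step : ∀ g i → potential (g ∙ lookup S i) ≤ suc (potential g)
  potential-step g i = subst (λ s → potential (g ∙ s) ≤ suc (potential g)) (sym (lookup-S i))
                             (potential-generator g (splitAt (suc n-2) i))

  farthest : Carrier
  farthest = (suc zero , λ _ → suc zero)

  potential-ε : potential ε ≡ 0
  potential-ε = cong (λ c → offset zero c + c) (weight-zero {m = n})

  potential-farthest : potential farthest ≡ suc n
  potential-farthest = trans (cong (λ c → offset (suc zero) c + c) (weight-nonzero {m = n} zero))
    (cong (λ b → (if b then 0 else 1) + n) (dec-false (_ ≟ᶠ _) (λ 1≡[n] → 1≢0 (trans 1≡[n] ℤn.[n]≡0#))))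
    where
    1≢0 : suc zero ≢ zero
    1≢0 ()

  farthest-far : ∀ ℓ → DistLe G S ε farthest ℓ → suc n ≤ ℓ
  farthest-far ℓ dist = subst₂ _≤_ potential-farthest (cong (_+ ℓ) potential-ε)
    (DistLe⇒potential≤ potential potential-cong potential-step dist)

  diameter : HasDiameter G S (suc n)
  diameter = DistLe-fromε reachable , ε , farthest , farthest-far

  cayleyDigraph : CayleyDigraph (suc n) D (n * q ^ n)
  cayleyDigraph = G , S , valid , diameter , Wreath.order (ℤ/ q) n ℤq.order

private
  colours : ∀ a b → 3 + a + b + 3 ∸ (4 + a) ≡ 2 + b
  colours a b = begin
    a + b + 3 ∸ suc a       ≡⟨ cong (_∸ suc a) (ℕₚ.+-assoc a b 3) ⟩
    a + (b + 3) ∸ suc a     ≡⟨ cong (λ m → a + m ∸ suc a) (ℕₚ.+-comm b 3) ⟩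
    a + (3 + b) ∸ suc a     ≡⟨ cong (_∸ suc a) (ℕₚ.+-suc a (2 + b)) ⟩
    suc a + (2 + b) ∸ suc a ≡⟨ ℕₚ.m+n∸m≡n (suc a) (2 + b) ⟩
    2 + b                   ∎
    where open P.≡-Reasoning

theorem1 : (k d : ℕ) → 4 ≤ k → k ∸ 1 ≤ d →
    Σ (Group 0ℓ 0ℓ) λ G → Σ (Vec (Group.Carrier G) d) λ S →
      ValidConnectionSet G S ×
      HasDiameter G S k ×
      HasOrder G ((k ∸ 1) * ((d + 3 ∸ k) ^ (k ∸ 1)))
theorem1 (suc (suc (suc (suc a)))) d (s≤s (s≤s (s≤s (s≤s z≤n)))) k-1≤d with ℕₚ.m≤n⇒∃[o]m+o≡n k-1≤d
... | b , refl = subst₂ (CayleyDigraph (4 + a)) (ℕₚ.+-suc (2 + a) b)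
                        (cong (λ q → (3 + a) * q ^ (3 + a)) (sym (colours a b)))
                        (Lamplighter.cayleyDigraph (suc a) b)
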